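{- Let $n\ge 4$ be an even integer and let $a,b,c,d$ be integers with $1\le a<n/2$ and $0\le b,c,d<n$ such that $b,c,d$ are pairwise distinct, $a,b,d$ are odd, $c$ is even, no prime divides all of $n,a,b,c,d$, and modulo $n$ we have $d\equiv 2a+b$ and $2c\equiv 3a+3b$. Then the graph $\mathrm{WH}_n(a,b,c,d)$ is vertex-transitive.
   Context: For an integer $n\ge 3$ and $a,b,c,d\in\mathbb{Z}_n$ with $2a\neq 0$, $b,c,d$ pairwise distinct, and such that no prime divides $n$ together with (integer representatives of) all of $a,b,c,d$, the Woolly Hat graph $\mathrm{WH}_n(a,b,c,d)$ is the graph with vertex set $\{A_i,B_i,C_i : i\in\mathbb{Z}_n\}$ with adjacencies, for each $i\in\mathbb{Z}_n$ (subscripts mod $n$): $A_i\sim A_{i-a},A_{i+a},B_i,C_i$; $B_i\sim A_i,C_{i+b},C_{i+c},C_{i+d}$; $C_i\sim A_i,B_{i-b},B_{i-c},B_{i-d}$. -}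

module Defs where

open import Data.Nat using (ℕ; _+_)
open import Data.Fin using (Fin; toℕ)
open import Data.Integer using (ℤ; +_; _-_)
open import Data.Integer.Divisibility using () renaming (_∣_ to _∣ℤ_)
open import Data.Sum using (_⊎_)
open import Data.Empty using (⊥)
open import Data.Product using (Σ; _×_)
open import Relation.Binary.PropositionalEquality using () renaming (_≡_ to _≡_)
open import Function.Bundles using (_↔_; Inverse)
open import Level using (0ℓ)

infix 4 _≡_[mod_]
_≡_[mod_] : ℕ → ℕ → ℕ → Set
x ≡ y [mod n ] = (+ n) ∣ℤ ((+ x) - (+ y))

data Vtx (n : ℕ) : Set where
  A B C : Fin n → Vtx n

WH : (n a b c d : ℕ) → Vtx n → Vtx n → Set
WH n a b c d (A i) (A j) = (toℕ j ≡ toℕ i + a [mod n ]) ⊎ (toℕ j + a ≡ toℕ i [mod n ])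
WH n a b c d (A i) (B j) = i ≡ j
WH n a b c d (A i) (C j) = i ≡ j
WH n a b c d (B i) (A j) = i ≡ j
WH n a b c d (B i) (B j) = ⊥
WH n a b c d (B i) (C j) =
  (toℕ j ≡ toℕ i + b [mod n ]) ⊎ ((toℕ j ≡ toℕ i + c [mod n ]) ⊎ (toℕ j ≡ toℕ i + d [mod n ]))
WH n a b c d (C i) (A j) = i ≡ j
WH n a b c d (C i) (B j) =
  (toℕ j + b ≡ toℕ i [mod n ]) ⊎ ((toℕ j + c ≡ toℕ i [mod n ]) ⊎ (toℕ j + d ≡ toℕ i [mod n ]))
WH n a b c d (C i) (C j) = ⊥

record Automorphism {V : Set} (E : V → V → Set) : Set where
  field
    perm : V ↔ V
    preserves : ∀ x y → E x y → E (Inverse.to perm x) (Inverse.to perm y)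
    reflects  : ∀ x y → E (Inverse.to perm x) (Inverse.to perm y) → E x y

VertexTransitive : {V : Set} → (E : V → V → Set) → Set
VertexTransitive {V} E = ∀ (u v : V) → Σ (Automorphism E) (λ σ → Inverse.to (Automorphism.perm σ) u ≡ v)

module Submission where

-- The rotations i ↦ i + k are automorphisms, so it suffices
-- to connect the three kinds. Since n is even, the parity of an index is well defined, and the map σ
-- acting on indices of even parity by  A_i ↦ B_{−i},  B_i ↦ A_{−i},  C_i ↦ C_{c−i},  and on odd ones by
-- A_i ↦ C_{α−i},  C_i ↦ A_{α−i},  B_i ↦ B_{β−i}  (α = a + b, β = a + b − c) is an involution, as all
-- these reflection constants are even. It maps edges to edges: A–A and B–C edges of odd offset join
-- indices of different parity (a, b, d odd), B–C edges of offset c (even) join indices of equal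
-- parity, and in every case the offset of the image edge follows from d ≡ 2a + b and 2c ≡ 3a + 3b.
-- Finally σ(A₀) = B₀ and σ(A₁) is a C-vertex.

open import Data.Nat.Base as ℕ using (ℕ; NonZero)
import Data.Nat.Divisibility as ℕ
import Data.Nat.DivMod as ℕ
import Data.Nat.Properties as ℕ
open import Data.Integer.Base as ℤ using (ℤ; +_; -_)
import Data.Integer.Properties as ℤ
open import Data.Integer.DivMod using (_%ℕ_; _/ℕ_; n%ℕd<d; a≡a%ℕn+[a/ℕn]*n)
open import Data.Integer.Divisibility.Signed as Signed using (divides; ∣ᵤ⇒∣; ∣⇒∣ᵤ; ∣m∣n⇒∣m+n; ∣m⇒∣-m; ∣-trans)
open import Data.Integer.Tactic.RingSolver using (solve-∀; solve)
open import Data.Fin.Base using (Fin; zero; suc; toℕ; fromℕ<)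
open import Data.Fin.Properties using (toℕ-fromℕ<; toℕ-injective; toℕ<n)
open import Data.List.Base using ([]; _∷_)
open import Data.Empty using (⊥; ⊥-elim)
open import Data.Product.Base using (Σ; _,_)
open import Data.Sum.Base as Sum using (_⊎_; inj₁; inj₂)
open import Function.Base using (_∘_)
open import Function.Bundles using (_⇔_; mk⇔; mk↔ₛ′; Inverse; Equivalence)
open import Function.Construct.Composition using (_↔-∘_; _⇔-∘_)
open import Function.Construct.Symmetry using (↔-sym)
open import Relation.Binary.Bundles using (Setoid)
open import Relation.Binary.Structures using (IsEquivalence)
import Relation.Binary.Reasoning.Setoid as SetoidReasoning
open import Relation.Binary.PropositionalEquality using (_≡_; refl; sym; trans; cong; cong₂; subst; subst₂)
open import Relation.Nullary using (¬_)
open import Defs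

Reachable : {V : Set} → (V → V → Set) → V → V → Set
Reachable E u v = Σ (Automorphism E) (λ φ → Inverse.to (Automorphism.perm φ) u ≡ v)

module _ {V : Set} {E : V → V → Set} where
  open Automorphism

  automorphism : (f g : V → V) → (∀ x → f (g x) ≡ x) → (∀ x → g (f x) ≡ x) →
                 (∀ x y → E x y → E (f x) (f y)) → (∀ x y → E x y → E (g x) (g y)) →
                 Automorphism E
  automorphism f g f∘g g∘f f-pres g-pres = record
    { perm      = mk↔ₛ′ f g f∘g g∘f
    ; preserves = f-pres
    ; reflects  = λ x y fx~fy → subst₂ E (g∘f x) (g∘f y) (g-pres _ _ fx~fy)
    }

  reachable-sym : ∀ {u v} → Reachable E u v → Reachable E v u
  reachable-sym {u} {v} (φ , φu≡v) = φ⁻¹ , trans (cong from (sym φu≡v)) (strictlyInverseʳ u)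
    where
    open Inverse (perm φ)
    φ⁻¹ : Automorphism E
    φ⁻¹ = record
      { perm      = ↔-sym (perm φ)
      ; preserves = λ x y x~y →
          reflects φ _ _ (subst₂ E (sym (strictlyInverseˡ x)) (sym (strictlyInverseˡ y)) x~y)
      ; reflects  = λ x y φ⁻¹x~φ⁻¹y →
          subst₂ E (strictlyInverseˡ x) (strictlyInverseˡ y) (preserves φ _ _ φ⁻¹x~φ⁻¹y)
      }

  reachable-trans : ∀ {u v w} → Reachable E u v → Reachable E v w → Reachable E u w
  reachable-trans (φ , φu≡v) (ψ , ψv≡w) = ψ∘φ , trans (cong (Inverse.to (perm ψ)) φu≡v) ψv≡w
    where
    ψ∘φ : Automorphism E
    ψ∘φ = record
      { perm      = perm ψ ↔-∘ perm φ
      ; preserves = λ x y x~y → preserves ψ _ _ (preserves φ _ _ x~y)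
      ; reflects  = λ x y ψφx~ψφy → reflects φ _ _ (reflects ψ _ _ ψφx~ψφy)
      }

  orbit⇒vertexTransitive : (z : V) → (∀ v → Reachable E z v) → VertexTransitive E
  orbit⇒vertexTransitive z reach u v = reachable-trans (reachable-sym (reach u)) (reach v)

module Congruence (m : ℤ) where
  open import Data.Integer.Base using (_+_; _-_)
  open import Data.Integer.Divisibility.Signed using (_∣_)

  -- A record rather than a synonym for m ∣ x - y, so that x and y can be inferred.
  infix 4 _≈_
  record _≈_ (x y : ℤ) : Set where
    constructor mod
    field divides-difference : m ∣ x - y
  open _≈_ public

  ≈-by-difference : ∀ {x y x′ y′} → x - y ≡ x′ - y′ → x ≈ y → x′ ≈ y′
  ≈-by-difference eq (mod m∣x-y) = mod (subst (m ∣_) eq m∣x-y)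

  ≈-by-difference⇔ : ∀ {x y x′ y′} → x - y ≡ x′ - y′ → x ≈ y ⇔ x′ ≈ y′
  ≈-by-difference⇔ eq = mk⇔ (≈-by-difference eq) (≈-by-difference (sym eq))

  ≈-refl : ∀ {x} → x ≈ x
  ≈-refl {x} = mod (subst (m ∣_) (sym (ℤ.+-inverseʳ x)) (divides (+ 0) refl))

  ≈-reflexive : ∀ {x y} → x ≡ y → x ≈ y
  ≈-reflexive refl = ≈-refl

  ≈-sym : ∀ {x y} → x ≈ y → y ≈ x
  ≈-sym {x} {y} (mod p) = mod (subst (m ∣_) (flip x y) (∣m⇒∣-m p))
    where
    flip : ∀ x y → - (x - y) ≡ y - x
    flip = solve-∀

  ≈-trans : ∀ {x y z} → x ≈ y → y ≈ z → x ≈ z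
  ≈-trans {x} {y} {z} (mod p) (mod q) = mod (subst (m ∣_) (telescope x y z) (∣m∣n⇒∣m+n p q))
    where
    telescope : ∀ x y z → (x - y) + (y - z) ≡ x - z
    telescope = solve-∀

  ≈-isEquivalence : IsEquivalence _≈_
  ≈-isEquivalence = record { refl = ≈-refl ; sym = ≈-sym ; trans = ≈-trans }

  ≈-setoid : Setoid _ _
  ≈-setoid = record { isEquivalence = ≈-isEquivalence }

  +-cong : ∀ {x x′ y y′} → x ≈ x′ → y ≈ y′ → x + y ≈ x′ + y′
  +-cong {x} {x′} {y} {y′} (mod p) (mod q) = mod (subst (m ∣_) (regroup x x′ y y′) (∣m∣n⇒∣m+n p q))
    where
    regroup : ∀ x x′ y y′ → (x - x′) + (y - y′) ≡ (x + y) - (x′ + y′)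
    regroup = solve-∀

  -‿cong : ∀ {x y} → x ≈ y → - x ≈ - y
  -‿cong {x} {y} (mod p) = mod (subst (m ∣_) (negate x y) (∣m⇒∣-m p))
    where
    negate : ∀ x y → - (x - y) ≡ - x - - y
    negate = solve-∀

  -‿cong₂ : ∀ {x x′ y y′} → x ≈ x′ → y ≈ y′ → x - y ≈ x′ - y′
  -‿cong₂ p q = +-cong p (-‿cong q)

  module ≈-Reasoning = SetoidReasoning ≈-setoid

  difference-swap : ∀ {s x y} → s - x ≈ y → s - y ≈ x
  difference-swap {s} {x} {y} s-x≈y = ≈-trans (-‿cong₂ (≈-refl {s}) (≈-sym s-x≈y)) (≈-reflexive (cancel s x))
    where
    cancel : ∀ s x → s - (s - x) ≡ x
    cancel = solve-∀

≈-weaken : ∀ {k m x y} → k Signed.∣ m → Congruence._≈_ m x y → Congruence._≈_ k x y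
≈-weaken k∣m (Congruence.mod m∣x-y) = Congruence.mod (∣-trans k∣m m∣x-y)

module Residues (m : ℕ) .{{_ : NonZero m}} where
  open import Data.Integer.Base using (_+_; _-_; _*_; ∣_∣)
  open Congruence (+ m)

  toℤ : Fin m → ℤ
  toℤ i = + toℕ i

  fromℤ : ℤ → Fin m
  fromℤ z = fromℕ< (n%ℕd<d z m)

  toℤ-fromℤ : ∀ z → toℤ (fromℤ z) ≈ z
  toℤ-fromℤ z = ≈-trans (≈-reflexive (cong +_ (toℕ-fromℕ< (n%ℕd<d z m))))
                        (≈-sym (mod (divides (z /ℕ m) z-r≡qm)))
    where
    r q : ℤ
    r = + (z %ℕ m)
    q = z /ℕ m
    cancel : ∀ r q → (r + q) - r ≡ q
    cancel = solve-∀
    z-r≡qm : z - r ≡ q * + m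
    z-r≡qm = trans (cong (_- r) (a≡a%ℕn+[a/ℕn]*n z m)) (cancel r (q * + m))

  toℤ-injective : ∀ {i j} → toℤ i ≈ toℤ j → i ≡ j
  toℤ-injective {i} {j} (mod m∣i-j) =
    toℕ-injective (ℤ.+-injective (ℤ.i-j≡0⇒i≡j _ _ (ℤ.∣i∣≡0⇒i≡0 ∣i-j∣≡0)))
    where
    ∣i-j∣<m : ∣ toℤ i - toℤ j ∣ ℕ.< m
    ∣i-j∣<m = subst (ℕ._< m) (cong ∣_∣ (sym (ℤ.m-n≡m⊖n (toℕ i) (toℕ j))))
                (ℕ.≤-<-trans (ℤ.∣m⊝n∣≤m⊔n (toℕ i) (toℕ j)) (ℕ.⊔-pres-<m (toℕ<n i) (toℕ<n j)))
    ∣i-j∣≡0 : ∣ toℤ i - toℤ j ∣ ≡ 0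
    ∣i-j∣≡0 = trans (sym (ℕ.m<n⇒m%n≡m ∣i-j∣<m)) (ℕ.n∣m⇒m%n≡0 _ m (∣⇒∣ᵤ m∣i-j))

  fromℤ-cong : ∀ {x y} → x ≈ y → fromℤ x ≡ fromℤ y
  fromℤ-cong {x} {y} x≈y = toℤ-injective (≈-trans (toℤ-fromℤ x) (≈-trans x≈y (≈-sym (toℤ-fromℤ y))))

  fromℤ-toℤ : ∀ i → fromℤ (toℤ i) ≡ i
  fromℤ-toℤ i = toℤ-injective (toℤ-fromℤ (toℤ i))

module Parities where
  open import Data.Integer.Base using (_+_; _-_)

  Parity : Set
  Parity = Fin 2

  pattern even = zero
  pattern odd  = suc zero

  even≢odd : ∀ {p : Parity} → p ≡ even → p ≡ odd → ⊥
  even≢odd refl ()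

  module Mod2 = Residues 2
  open Mod2 public using () renaming (toℤ to toℤ₂)
  private module C = Congruence (+ 2)

  parity : ℤ → Parity
  parity = Mod2.fromℤ

  -- Phrased through parities p and q so that, for closed p and q, the right-hand side computes.
  parity-+ : ∀ x y {p q} → parity x ≡ p → parity y ≡ q → parity (x + y) ≡ parity (toℤ₂ p + toℤ₂ q)
  parity-+ x y refl refl =
    Mod2.fromℤ-cong (C.+-cong (C.≈-sym (Mod2.toℤ-fromℤ x)) (C.≈-sym (Mod2.toℤ-fromℤ y)))

  parity-neg : ∀ x {p} → parity x ≡ p → parity (- x) ≡ parity (- toℤ₂ p)
  parity-neg x refl = Mod2.fromℤ-cong (C.-‿cong (C.≈-sym (Mod2.toℤ-fromℤ x)))

  parity-minus : ∀ x y {p q} → parity x ≡ p → parity y ≡ q → parity (x - y) ≡ parity (toℤ₂ p - toℤ₂ q)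
  parity-minus x y refl refl =
    Mod2.fromℤ-cong (C.-‿cong₂ (C.≈-sym (Mod2.toℤ-fromℤ x)) (C.≈-sym (Mod2.toℤ-fromℤ y)))

  parity-even : ∀ {x} → 2 ℕ.∣ x → parity (+ x) ≡ even
  parity-even {x} 2∣x = toℕ-injective (trans (toℕ-fromℕ< _) (ℕ.n∣m⇒m%n≡0 x 2 2∣x))

  parity-odd : ∀ {x} → ¬ 2 ℕ.∣ x → parity (+ x) ≡ odd
  parity-odd {x} 2∤x with parity (+ x) in eq
  ... | even = ⊥-elim (2∤x (ℕ.m%n≡0⇒n∣m x 2 (trans (sym (toℕ-fromℕ< _)) (cong toℕ eq))))
  ... | odd  = refl

open Parities

-- If j − i ≡ x and σ reflects i about k and j about l, the images differ by (l − k) − x. These are the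
-- congruences (l − k) − x ≈ y that identify the image offset y for each kind of edge; as σ is an
-- involution, each comes with its swap (l − k) − y ≈ x.
module ReflectionOffsets (m a b c d : ℤ)
  (d≈2a+b : Congruence._≈_ m d (+ 2 ℤ.* a ℤ.+ b))
  (2c≈3a+3b : Congruence._≈_ m (+ 2 ℤ.* c) (+ 3 ℤ.* a ℤ.+ + 3 ℤ.* b)) where
  open import Data.Integer.Base using (_+_; _-_; _*_)
  open Congruence m
  open ≈-Reasoning

  [a+b]-a≈b : ((a + b) - + 0) - a ≈ b
  [a+b]-a≈b = ≈-reflexive (solve (a ∷ b ∷ []))

  [a+b]+a≈d : ((a + b) - + 0) - - a ≈ d
  [a+b]+a≈d = begin
    ((a + b) - + 0) - - a  ≡⟨ solve (a ∷ b ∷ []) ⟩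
    + 2 * a + b            ≈⟨ ≈-sym d≈2a+b ⟩
    d                      ∎

  [a+b]-[a+b-c]≈c : ((a + b) - ((a + b) - c)) - + 0 ≈ c
  [a+b]-[a+b-c]≈c = ≈-reflexive (solve (a ∷ b ∷ c ∷ []))

  c-0≈c : (c - + 0) - + 0 ≈ c
  c-0≈c = ≈-reflexive (solve (c ∷ []))

  c-[a+b-c]-b≈d : (c - ((a + b) - c)) - b ≈ d
  c-[a+b-c]-b≈d = begin
    (c - ((a + b) - c)) - b    ≡⟨ solve (a ∷ b ∷ c ∷ []) ⟩
    + 2 * c - (a + + 2 * b)    ≈⟨ -‿cong₂ 2c≈3a+3b ≈-refl ⟩
    (+ 3 * a + + 3 * b) - (a + + 2 * b) ≡⟨ solve (a ∷ b ∷ []) ⟩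
    + 2 * a + b                ≈⟨ ≈-sym d≈2a+b ⟩
    d                          ∎

  [a+b]-b≈a : ((a + b) - + 0) - b ≈ a
  [a+b]-b≈a = difference-swap {(a + b) - + 0} [a+b]-a≈b

  [a+b]-d≈-a : ((a + b) - + 0) - d ≈ - a
  [a+b]-d≈-a = difference-swap {(a + b) - + 0} [a+b]+a≈d

  [a+b]-[a+b-c]-c≈0 : ((a + b) - ((a + b) - c)) - c ≈ + 0
  [a+b]-[a+b-c]-c≈0 = difference-swap {(a + b) - ((a + b) - c)} [a+b]-[a+b-c]≈c

  c-c≈0 : (c - + 0) - c ≈ + 0
  c-c≈0 = difference-swap {c - + 0} c-0≈c

  c-[a+b-c]-d≈b : (c - ((a + b) - c)) - d ≈ b
  c-[a+b-c]-d≈b = difference-swap {c - ((a + b) - c)} c-[a+b-c]-b≈d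

module WoollyHat (n : ℕ) .{{_ : NonZero n}} (a b c d : ℕ) where
  open import Data.Integer.Base using (_+_; _-_; _*_)
  open Congruence (+ n)
  open Residues n
  open Equivalence using (to; from)

  infix 4 _~_
  _~_ : Vtx n → Vtx n → Set
  _~_ = WH n a b c d

  index : Vtx n → Fin n
  index (A i) = i
  index (B i) = i
  index (C i) = i

  reindex : Vtx n → Fin n → Vtx n
  reindex (A _) j = A j
  reindex (B _) j = B j
  reindex (C _) j = C j

  Δ : Fin n → Fin n → ℤ
  Δ i j = toℤ j - toℤ i

  ≡mod⇔≈ : ∀ x y → x ≡ y [mod n ] ⇔ + x ≈ + y
  ≡mod⇔≈ x y = mk⇔ (mod ∘ ∣ᵤ⇒∣) (∣⇒∣ᵤ ∘ divides-difference)

  ≡mod-sym : ∀ x y → x ≡ y [mod n ] → y ≡ x [mod n ]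
  ≡mod-sym x y = from (≡mod⇔≈ y x) ∘ ≈-sym ∘ to (≡mod⇔≈ x y)

  offset⇔ : ∀ i j x → toℕ j ≡ toℕ i ℕ.+ x [mod n ] ⇔ Δ i j ≈ + x
  offset⇔ i j x = ≈-by-difference⇔ (regroup (toℤ j) (toℤ i) (+ x)) ⇔-∘ ≡mod⇔≈ (toℕ j) (toℕ i ℕ.+ x)
    where
    regroup : ∀ j i x → j - (i + x) ≡ (j - i) - x
    regroup = solve-∀

  neg-offset⇔ : ∀ i j x → toℕ j ℕ.+ x ≡ toℕ i [mod n ] ⇔ Δ i j ≈ - + x
  neg-offset⇔ i j x = ≈-by-difference⇔ (regroup (toℤ j) (toℤ i) (+ x)) ⇔-∘ ≡mod⇔≈ (toℕ j ℕ.+ x) (toℕ i)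
    where
    regroup : ∀ j i x → (j + x) - i ≡ (j - i) - - x
    regroup = solve-∀

  A~A⇔ : ∀ i j → A i ~ A j ⇔ (Δ i j ≈ + a ⊎ Δ i j ≈ - + a)
  A~A⇔ i j = mk⇔ (Sum.map (to (offset⇔ i j a)) (to (neg-offset⇔ i j a)))
                 (Sum.map (from (offset⇔ i j a)) (from (neg-offset⇔ i j a)))

  B~C⇔ : ∀ i j → B i ~ C j ⇔ (Δ i j ≈ + b ⊎ Δ i j ≈ + c ⊎ Δ i j ≈ + d)
  B~C⇔ i j = mk⇔ (Sum.map (to (offset⇔ i j b)) (Sum.map (to (offset⇔ i j c)) (to (offset⇔ i j d))))
                 (Sum.map (from (offset⇔ i j b)) (Sum.map (from (offset⇔ i j c)) (from (offset⇔ i j d))))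

  Δ≈0⇒≡ : ∀ {i j} → Δ i j ≈ + 0 → i ≡ j
  Δ≈0⇒≡ {i} {j} Δ≈0 = sym (toℤ-injective (≈-by-difference (ℤ.+-identityʳ (toℤ j - toℤ i)) Δ≈0))

  ~-sym : ∀ x y → x ~ y → y ~ x
  ~-sym (A i) (A j) (inj₁ h)        = inj₂ (≡mod-sym (toℕ j) (toℕ i ℕ.+ a) h)
  ~-sym (A i) (A j) (inj₂ h)        = inj₁ (≡mod-sym (toℕ j ℕ.+ a) (toℕ i) h)
  ~-sym (A i) (B j) h               = sym h
  ~-sym (A i) (C j) h               = sym h
  ~-sym (B i) (A j) h               = sym h
  ~-sym (B i) (C j) (inj₁ h)        = inj₁ (≡mod-sym (toℕ j) (toℕ i ℕ.+ b) h)
  ~-sym (B i) (C j) (inj₂ (inj₁ h)) = inj₂ (inj₁ (≡mod-sym (toℕ j) (toℕ i ℕ.+ c) h))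
  ~-sym (B i) (C j) (inj₂ (inj₂ h)) = inj₂ (inj₂ (≡mod-sym (toℕ j) (toℕ i ℕ.+ d) h))
  ~-sym (C i) (A j) h               = sym h
  ~-sym (C i) (B j) (inj₁ h)        = inj₁ (≡mod-sym (toℕ j ℕ.+ b) (toℕ i) h)
  ~-sym (C i) (B j) (inj₂ (inj₁ h)) = inj₂ (inj₁ (≡mod-sym (toℕ j ℕ.+ c) (toℕ i) h))
  ~-sym (C i) (B j) (inj₂ (inj₂ h)) = inj₂ (inj₂ (≡mod-sym (toℕ j ℕ.+ d) (toℕ i) h))

  ~-preserved : (f : Vtx n → Vtx n) →
    (∀ {i j} → A i ~ A j → f (A i) ~ f (A j)) →
    (∀ i → f (A i) ~ f (B i)) →
    (∀ i → f (A i) ~ f (C i)) →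
    (∀ {i j} → B i ~ C j → f (B i) ~ f (C j)) →
    ∀ x y → x ~ y → f x ~ f y
  ~-preserved f AA AB AC BC (A i) (A j) h    = AA h
  ~-preserved f AA AB AC BC (A i) (B .i) refl = AB i
  ~-preserved f AA AB AC BC (A i) (C .i) refl = AC i
  ~-preserved f AA AB AC BC (B i) (A .i) refl = ~-sym (f (A i)) (f (B i)) (AB i)
  ~-preserved f AA AB AC BC (B i) (C j) h    = BC h
  ~-preserved f AA AB AC BC (C i) (A .i) refl = ~-sym (f (A i)) (f (C i)) (AC i)
  ~-preserved f AA AB AC BC (C i) (B j) h    = ~-sym (f (B j)) (f (C i)) (BC (~-sym (C i) (B j) h))

  Δ-fromℤ : ∀ x y → Δ (fromℤ x) (fromℤ y) ≈ y - x
  Δ-fromℤ x y = -‿cong₂ (toℤ-fromℤ y) (toℤ-fromℤ x)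

  rotate : ℤ → Fin n → Fin n
  rotate k i = fromℤ (toℤ i + k)

  rotate-offset : ∀ k {i j x} → Δ i j ≈ x → Δ (rotate k i) (rotate k j) ≈ x
  rotate-offset k {i} {j} Δ≈x =
    ≈-trans (Δ-fromℤ (toℤ i + k) (toℤ j + k)) (≈-trans (≈-reflexive (cancel (toℤ j) (toℤ i) k)) Δ≈x)
    where
    cancel : ∀ j i k → (j + k) - (i + k) ≡ j - i
    cancel = solve-∀

  rotate-cancel : ∀ k l → k + l ≡ + 0 → ∀ i → rotate l (rotate k i) ≡ i
  rotate-cancel k l k+l≡0 i =
    trans (fromℤ-cong (+-cong (toℤ-fromℤ (toℤ i + k)) (≈-refl {l}))) (trans (cong fromℤ i+k+l≡i) (fromℤ-toℤ i))
    where
    i+k+l≡i : (toℤ i + k) + l ≡ toℤ i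
    i+k+l≡i = trans (ℤ.+-assoc (toℤ i) k l) (trans (cong (_+_ (toℤ i)) k+l≡0) (ℤ.+-identityʳ (toℤ i)))

  rotate-between : ∀ i j → rotate (toℤ j - toℤ i) i ≡ j
  rotate-between i j = trans (cong fromℤ (telescope (toℤ i) (toℤ j))) (fromℤ-toℤ j)
    where
    telescope : ∀ i j → i + (j - i) ≡ j
    telescope = solve-∀

  ρ : ℤ → Vtx n → Vtx n
  ρ k x = reindex x (rotate k (index x))

  ρ-preserves : ∀ k x y → x ~ y → ρ k x ~ ρ k y
  ρ-preserves k = ~-preserved (ρ k) A~A (λ _ → refl) (λ _ → refl) B~C
    where
    A~A : ∀ {i j} → A i ~ A j → ρ k (A i) ~ ρ k (A j)
    A~A {i} {j} = from (A~A⇔ (rotate k i) (rotate k j))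
                ∘ Sum.map (rotate-offset k) (rotate-offset k) ∘ to (A~A⇔ i j)
    B~C : ∀ {i j} → B i ~ C j → ρ k (B i) ~ ρ k (C j)
    B~C {i} {j} = from (B~C⇔ (rotate k i) (rotate k j))
                ∘ Sum.map (rotate-offset k) (Sum.map (rotate-offset k) (rotate-offset k)) ∘ to (B~C⇔ i j)

  ρ-cancel : ∀ k l → k + l ≡ + 0 → ∀ x → ρ l (ρ k x) ≡ x
  ρ-cancel k l k+l≡0 (A i) = cong A (rotate-cancel k l k+l≡0 i)
  ρ-cancel k l k+l≡0 (B i) = cong B (rotate-cancel k l k+l≡0 i)
  ρ-cancel k l k+l≡0 (C i) = cong C (rotate-cancel k l k+l≡0 i)

  rotation : ℤ → Automorphism _~_
  rotation k = automorphism (ρ k) (ρ (- k))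
    (ρ-cancel (- k) k (ℤ.+-inverseˡ k)) (ρ-cancel k (- k) (ℤ.+-inverseʳ k)) (ρ-preserves k) (ρ-preserves (- k))

  reachable-by-rotation : ∀ x j → Reachable _~_ x (reindex x j)
  reachable-by-rotation x j = rotation (toℤ j - toℤ (index x)) , cong (reindex x) (rotate-between (index x) j)

  reflect : ℤ → Fin n → Fin n
  reflect k i = fromℤ (k - toℤ i)

  reflect-involutive : ∀ k i → reflect k (reflect k i) ≡ i
  reflect-involutive k i = trans (fromℤ-cong (-‿cong₂ (≈-refl {k}) (toℤ-fromℤ (k - toℤ i))))
                                 (trans (cong fromℤ (cancel k (toℤ i))) (fromℤ-toℤ i))
    where
    cancel : ∀ k i → k - (k - i) ≡ i
    cancel = solve-∀

  reflect-offset : ∀ k l i j {x} → Δ i j ≈ x → Δ (reflect k i) (reflect l j) ≈ (l - k) - x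
  reflect-offset k l i j Δ≈x =
    ≈-trans (Δ-fromℤ (k - toℤ i) (l - toℤ j))
            (≈-trans (≈-reflexive (regroup k l (toℤ i) (toℤ j))) (-‿cong₂ (≈-refl {l - k}) Δ≈x))
    where
    regroup : ∀ k l i j → (l - j) - (k - i) ≡ (l - k) - (j - i)
    regroup = solve-∀

  Δ-refl : ∀ i → Δ i i ≈ + 0
  Δ-refl i = ≈-reflexive (ℤ.+-inverseʳ (toℤ i))

  module Involution
    (2∣n : 2 ℕ.∣ n) (2∤a : ¬ 2 ℕ.∣ a) (2∤b : ¬ 2 ℕ.∣ b) (2∤d : ¬ 2 ℕ.∣ d) (2∣c : 2 ℕ.∣ c)
    (d≡2a+b : d ≡ 2 ℕ.* a ℕ.+ b [mod n ])
    (2c≡3a+3b : 2 ℕ.* c ≡ 3 ℕ.* a ℕ.+ 3 ℕ.* b [mod n ]) where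

    α β : ℤ
    α = + a + + b
    β = α - + c

    d≈2a+b : + d ≈ + 2 * + a + + b
    d≈2a+b = ≈-trans (to (≡mod⇔≈ d (2 ℕ.* a ℕ.+ b)) d≡2a+b)
                     (≈-reflexive (trans (ℤ.pos-+ (2 ℕ.* a) b) (cong (λ x → x + + b) (ℤ.pos-* 2 a))))

    2c≈3a+3b : + 2 * + c ≈ + 3 * + a + + 3 * + b
    2c≈3a+3b = ≈-trans (≈-reflexive (sym (ℤ.pos-* 2 c)))
                 (≈-trans (to (≡mod⇔≈ (2 ℕ.* c) (3 ℕ.* a ℕ.+ 3 ℕ.* b)) 2c≡3a+3b)
                   (≈-reflexive (trans (ℤ.pos-+ (3 ℕ.* a) (3 ℕ.* b)) (cong₂ _+_ (ℤ.pos-* 3 a) (ℤ.pos-* 3 b)))))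

    open ReflectionOffsets (+ n) (+ a) (+ b) (+ c) (+ d) d≈2a+b 2c≈3a+3b

    parity-resp : ∀ {x y} → x ≈ y → parity x ≡ parity y
    parity-resp = Mod2.fromℤ-cong ∘ ≈-weaken (∣ᵤ⇒∣ 2∣n)

    a-odd : parity (+ a) ≡ odd
    a-odd = parity-odd 2∤a
    b-odd : parity (+ b) ≡ odd
    b-odd = parity-odd 2∤b
    d-odd : parity (+ d) ≡ odd
    d-odd = parity-odd 2∤d
    c-even : parity (+ c) ≡ even
    c-even = parity-even 2∣c
    α-even : parity α ≡ even
    α-even = parity-+ (+ a) (+ b) a-odd b-odd
    β-even : parity β ≡ even
    β-even = parity-minus α (+ c) α-even c-even

    parityOf : Vtx n → Parity
    parityOf x = parity (toℤ (index x))

    σ′ : Parity → Vtx n → Vtx n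
    σ′ even (A i) = B (reflect (+ 0) i)
    σ′ odd  (A i) = C (reflect α i)
    σ′ even (B i) = A (reflect (+ 0) i)
    σ′ odd  (B i) = B (reflect β i)
    σ′ even (C i) = C (reflect (+ c) i)
    σ′ odd  (C i) = A (reflect α i)

    σ : Vtx n → Vtx n
    σ x = σ′ (parityOf x) x

    reflect-parity : ∀ k → parity k ≡ even → ∀ i → parity (toℤ (reflect k i)) ≡ parity (toℤ i)
    reflect-parity k k-even i = trans (parity-resp (toℤ-fromℤ (k - toℤ i)))
                                      (trans (parity-minus k (toℤ i) k-even refl) (negate (parity (toℤ i))))
      where
      negate : ∀ p → parity (+ 0 - toℤ₂ p) ≡ p
      negate even = refl
      negate odd  = refl

    σ′-parity : ∀ p x → parityOf (σ′ p x) ≡ parityOf x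
    σ′-parity even (A i) = reflect-parity (+ 0) refl i
    σ′-parity odd  (A i) = reflect-parity α α-even i
    σ′-parity even (B i) = reflect-parity (+ 0) refl i
    σ′-parity odd  (B i) = reflect-parity β β-even i
    σ′-parity even (C i) = reflect-parity (+ c) c-even i
    σ′-parity odd  (C i) = reflect-parity α α-even i

    σ′-involutive : ∀ p x → σ′ p (σ′ p x) ≡ x
    σ′-involutive even (A i) = cong A (reflect-involutive (+ 0) i)
    σ′-involutive odd  (A i) = cong A (reflect-involutive α i)
    σ′-involutive even (B i) = cong B (reflect-involutive (+ 0) i)
    σ′-involutive odd  (B i) = cong B (reflect-involutive β i)
    σ′-involutive even (C i) = cong C (reflect-involutive (+ c) i)
    σ′-involutive odd  (C i) = cong C (reflect-involutive α i)

    σ-involutive : ∀ x → σ (σ x) ≡ x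
    σ-involutive x =
      trans (cong (λ p → σ′ p (σ x)) (σ′-parity (parityOf x) x)) (σ′-involutive (parityOf x) x)

    Δ-parity : ∀ i j {p q} → parity (toℤ i) ≡ p → parity (toℤ j) ≡ q →
               parity (Δ i j) ≡ parity (toℤ₂ q - toℤ₂ p)
    Δ-parity i j pi pj = parity-minus (toℤ j) (toℤ i) pj pi

    offset-parity : ∀ i j {p q x} → parity (toℤ i) ≡ p → parity (toℤ j) ≡ q → Δ i j ≈ x →
                    parity x ≡ parity (toℤ₂ q - toℤ₂ p)
    offset-parity i j pi pj Δ≈x = trans (sym (parity-resp Δ≈x)) (Δ-parity i j pi pj)

    A~A⇒odd-offset : ∀ {i j} → A i ~ A j → parity (Δ i j) ≡ odd
    A~A⇒odd-offset {i} {j} h with to (A~A⇔ i j) h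
    ... | inj₁ Δ≈a  = trans (parity-resp Δ≈a) a-odd
    ... | inj₂ Δ≈-a = trans (parity-resp Δ≈-a) (parity-neg (+ a) a-odd)

    σ′-A~A-even-odd : ∀ {i j} → A i ~ A j → σ′ even (A i) ~ σ′ odd (A j)
    σ′-A~A-even-odd {i} {j} h with to (A~A⇔ i j) h
    ... | inj₁ Δ≈a  = from (B~C⇔ (reflect (+ 0) i) (reflect α j))
                        (inj₁ (≈-trans (reflect-offset (+ 0) α i j Δ≈a) [a+b]-a≈b))
    ... | inj₂ Δ≈-a = from (B~C⇔ (reflect (+ 0) i) (reflect α j))
                        (inj₂ (inj₂ (≈-trans (reflect-offset (+ 0) α i j Δ≈-a) [a+b]+a≈d)))

    σ′-A~A : ∀ {i j p q} → parity (toℤ i) ≡ p → parity (toℤ j) ≡ q → A i ~ A j →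
             σ′ p (A i) ~ σ′ q (A j)
    σ′-A~A {i} {j} {even} {even} pi pj h = ⊥-elim (even≢odd (Δ-parity i j pi pj) (A~A⇒odd-offset {i} {j} h))
    σ′-A~A {i} {j} {odd}  {odd}  pi pj h = ⊥-elim (even≢odd (Δ-parity i j pi pj) (A~A⇒odd-offset {i} {j} h))
    σ′-A~A {i} {j} {even} {odd}  pi pj h = σ′-A~A-even-odd {i} {j} h
    σ′-A~A {i} {j} {odd}  {even} pi pj h =
      ~-sym (σ′ even (A j)) (σ′ odd (A i)) (σ′-A~A-even-odd {j} {i} (~-sym (A i) (A j) h))

    σ′-A~B : ∀ p i → σ′ p (A i) ~ σ′ p (B i)
    σ′-A~B even i = refl
    σ′-A~B odd  i = ~-sym (B (reflect β i)) (C (reflect α i))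
                      (from (B~C⇔ (reflect β i) (reflect α i))
                        (inj₂ (inj₁ (≈-trans (reflect-offset β α i i (Δ-refl i)) [a+b]-[a+b-c]≈c))))

    σ′-A~C : ∀ p i → σ′ p (A i) ~ σ′ p (C i)
    σ′-A~C even i = from (B~C⇔ (reflect (+ 0) i) (reflect (+ c) i))
                      (inj₂ (inj₁ (≈-trans (reflect-offset (+ 0) (+ c) i i (Δ-refl i)) c-0≈c)))
    σ′-A~C odd  i = refl

    σ′-B~C : ∀ {i j p q} → parity (toℤ i) ≡ p → parity (toℤ j) ≡ q → B i ~ C j →
             σ′ p (B i) ~ σ′ q (C j)
    σ′-B~C {i} {j} {even} {even} pi pj h with to (B~C⇔ i j) h
    ... | inj₁ Δ≈b        = ⊥-elim (even≢odd (offset-parity i j pi pj Δ≈b) b-odd)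
    ... | inj₂ (inj₁ Δ≈c) = Δ≈0⇒≡ (≈-trans (reflect-offset (+ 0) (+ c) i j Δ≈c) c-c≈0)
    ... | inj₂ (inj₂ Δ≈d) = ⊥-elim (even≢odd (offset-parity i j pi pj Δ≈d) d-odd)
    σ′-B~C {i} {j} {odd} {odd} pi pj h with to (B~C⇔ i j) h
    ... | inj₁ Δ≈b        = ⊥-elim (even≢odd (offset-parity i j pi pj Δ≈b) b-odd)
    ... | inj₂ (inj₁ Δ≈c) = Δ≈0⇒≡ (≈-trans (reflect-offset β α i j Δ≈c) [a+b]-[a+b-c]-c≈0)
    ... | inj₂ (inj₂ Δ≈d) = ⊥-elim (even≢odd (offset-parity i j pi pj Δ≈d) d-odd)
    σ′-B~C {i} {j} {even} {odd} pi pj h with to (B~C⇔ i j) h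
    ... | inj₁ Δ≈b        = from (A~A⇔ (reflect (+ 0) i) (reflect α j))
                              (inj₁ (≈-trans (reflect-offset (+ 0) α i j Δ≈b) [a+b]-b≈a))
    ... | inj₂ (inj₁ Δ≈c) = ⊥-elim (even≢odd c-even (offset-parity i j pi pj Δ≈c))
    ... | inj₂ (inj₂ Δ≈d) = from (A~A⇔ (reflect (+ 0) i) (reflect α j))
                              (inj₂ (≈-trans (reflect-offset (+ 0) α i j Δ≈d) [a+b]-d≈-a))
    σ′-B~C {i} {j} {odd} {even} pi pj h with to (B~C⇔ i j) h
    ... | inj₁ Δ≈b        = from (B~C⇔ (reflect β i) (reflect (+ c) j))
                              (inj₂ (inj₂ (≈-trans (reflect-offset β (+ c) i j Δ≈b) c-[a+b-c]-b≈d)))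
    ... | inj₂ (inj₁ Δ≈c) = ⊥-elim (even≢odd c-even (offset-parity i j pi pj Δ≈c))
    ... | inj₂ (inj₂ Δ≈d) = from (B~C⇔ (reflect β i) (reflect (+ c) j))
                              (inj₁ (≈-trans (reflect-offset β (+ c) i j Δ≈d) c-[a+b-c]-d≈b))

    σ-preserves : ∀ x y → x ~ y → σ x ~ σ y
    σ-preserves = ~-preserved σ
      (λ {i} {j} → σ′-A~A {i} {j} refl refl) (λ i → σ′-A~B (parityOf (A i)) i)
      (λ i → σ′-A~C (parityOf (A i)) i)      (λ {i} {j} → σ′-B~C {i} {j} refl refl)

    reflection : Automorphism _~_
    reflection = automorphism σ σ σ-involutive σ-involutive σ-preserves σ-preserves

    reachable-by-reflection : ∀ {p} x → parityOf x ≡ p → Reachable _~_ x (σ′ p x)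
    reachable-by-reflection x refl = reflection , refl

    A₀ : Vtx n
    A₀ = A (fromℤ (+ 0))

    A₀-reaches : ∀ v → Reachable _~_ A₀ v
    A₀-reaches (A j) = reachable-by-rotation A₀ j
    A₀-reaches (B j) = reachable-trans (reachable-by-reflection A₀ (parity-resp (toℤ-fromℤ (+ 0))))
                                       (reachable-by-rotation (B _) j)
    A₀-reaches (C j) = reachable-trans (reachable-by-rotation A₀ (fromℤ (+ 1)))
      (reachable-trans (reachable-by-reflection (A (fromℤ (+ 1))) (parity-resp (toℤ-fromℤ (+ 1))))
                       (reachable-by-rotation (C _) j))

    vertexTransitive : VertexTransitive _~_
    vertexTransitive = orbit⇒vertexTransitive A₀ A₀-reaches

open import Data.Nat using (_+_; _*_; _≤_; _<_)
open import Data.Nat.Divisibility using (_∣_)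
open import Data.Nat.Primality using (Prime)
open import Relation.Binary.PropositionalEquality using (_≢_)

proposition4p1 : (n a b c d : ℕ) →
    4 ≤ n → 2 ∣ n →
    1 ≤ a → 2 * a < n →
    b < n → c < n → d < n →
    b ≢ c → b ≢ d → c ≢ d →
    ¬ (2 ∣ a) → ¬ (2 ∣ b) → ¬ (2 ∣ d) → 2 ∣ c →
    (∀ p → Prime p → p ∣ n → p ∣ a → p ∣ b → p ∣ c → ¬ (p ∣ d)) →
    d ≡ 2 * a + b [mod n ] →
    2 * c ≡ 3 * a + 3 * b [mod n ] →
    VertexTransitive (WH n a b c d)
-- The bounds, the distinctness of b, c, d and the prime condition only make WH a simple 4-regular
-- graph; vertex-transitivity does not need them.
proposition4p1 n a b c d 4≤n 2∣n _ _ _ _ _ _ _ _ 2∤a 2∤b 2∤d 2∣c _ d≡2a+b 2c≡3a+3b =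
  Involution.vertexTransitive 2∣n 2∤a 2∤b 2∤d 2∣c d≡2a+b 2c≡3a+3b
  where
  instance
    n≢0 : NonZero n
    n≢0 = ℕ.>-nonZero (ℕ.≤-trans (ℕ.s≤s ℕ.z≤n) 4≤n)
  open WoollyHat n a b c d
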